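{- Let $\beta=(3,5)$ and $\beta^{ -1}=(5,3)$, where $\beta^j$ denotes $j$ concatenated copies, and let $q\ge2$. With a suitable choice of the middle sign of $\mathbf f(\tfrac{q-1}q)$: - if $q$ is even, then $C_{\frac{q-1}q}=\beta^{\frac{q-2}2},3,4,(\beta^{ -1})^{\frac{q-2}2}$; - if $q$ is odd, then $C_{\frac{q-1}q}=\beta^{\frac{q-3}2},3,5,4,3,(\beta^{ -1})^{\frac{q-3}2}$.
   Context: Lattice. Use the lattice of unit segments on the lines $y=c$, $x=c$, $y=-x+c$ ($c\in\mathbb Z$). Sign sequence $\mathbf f(\tfrac pq)$. For coprime positive $p\le q$, let $\gamma$ be the segment from $(0,0)$ to $(q,p)$, oriented away from the origin, crossing lattice segments $\sigma_1,\ldots,\sigma_N$ ($N=2(p+q)-3$) in order at points $s_i$. Then $\mathbf f(\tfrac pq)=(f_0,\ldots,f_{2N})$ is defined as follows. - $f_0=-$ and $f_{2N}=+$. - $f_{2i-1}=-$ if $s_i$ is closer to the endpoint of $\sigma_i$ to the right of $\gamma$, and $+$ if closer to the left one. The middle crossing is at a midpoint and may receive either sign. - $f_{2i}=-$ if the common endpoint of $\sigma_i,\sigma_{i+1}$ is to the right of $\gamma$, and $+$ otherwise. $C_{\frac pq}$ is the sequence of lengths of maximal blocks of consecutive equal signs in $\mathbf f(\tfrac pq)$. -}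

module Defs where

open import Data.Nat as ℕ using (ℕ; zero; suc; _∸_)
open import Data.Nat.DivMod using (_/_; _%_)
open import Data.Integer as ℤ using (ℤ; +_; _-_; _<?_)
import Data.Integer.Properties as ℤP
open import Data.Bool using (Bool; true; false; if_then_else_; _∨_)
open import Data.List using (List; []; _∷_; _++_; concat; replicate; concatMap; upTo)
open import Data.Product using (_×_; _,_; proj₁; proj₂)
open import Relation.Nullary.Decidable using (⌊_⌋)

data Sign : Set where
  minus plus : Sign

sameSign : Sign → Sign → Bool
sameSign minus minus = true
sameSign plus  plus  = true
sameSign _     _     = false

Point : Set
Point = ℤ × ℤ

Segment : Set
Segment = Point × Point

_==ℕ_ : ℕ → ℕ → Bool
m ==ℕ n = ⌊ m ℕ.≟ n ⌋

_==P_ : Point → Point → Bool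
(a , b) ==P (c , d) = ⌊ a ℤ.≟ c ⌋ Data.Bool.∧ ⌊ b ℤ.≟ d ⌋

fl : ℕ → ℕ → ℕ
fl a zero    = zero
fl a (suc d) = a / suc d

dvd : ℕ → ℕ → Bool
dvd zero    a = false
dvd (suc d) a = (a % suc d) ==ℕ 0

-- Common denominator for the crossing parameters along γ(t) = (t q , t p).
Den : ℕ → ℕ → ℕ
Den p q = p ℕ.* q ℕ.* (p ℕ.+ q)

-- Crossing at parameter t = k / Den p q (if any): γ(t) = (k q / D , k p / D).
crossingAt : ℕ → ℕ → ℕ → List (ℕ × Segment)
crossingAt p q k =
  if dvd D xN then
    (let c = fl xN D ; y0 = fl yN D in
     (k , ((+ c , + y0) , (+ c , + suc y0))) ∷ [])
  else if dvd D yN then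
    (let c = fl yN D ; x0 = fl xN D in
     (k , ((+ x0 , + c) , (+ suc x0 , + c))) ∷ [])
  else if dvd D (xN ℕ.+ yN) then
    (let c = fl (xN ℕ.+ yN) D ; i = fl xN D in
     (k , ((+ i , + c - + i) , (+ suc i , + c - + suc i))) ∷ [])
  else []
  where
  D  = Den p q
  xN = k ℕ.* q
  yN = k ℕ.* p

-- The crossings σ₁,…,σ_N of γ with the lattice, in order along γ
-- (k ranges over 1 … D-1, the open segment γ).
crossings : ℕ → ℕ → List (ℕ × Segment)
crossings p q = concatMap (λ j → crossingAt p q (suc j)) (upTo (Den p q ∸ 1))

-- cross product of the direction (q , p) of γ with a point: negative iff the
-- point is strictly to the right of γ (oriented away from the origin).
side : ℕ → ℕ → Point → ℤ
side p q (x , y) = + q ℤ.* y - + p ℤ.* x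

isRight : ℕ → ℕ → Point → Bool
isRight p q A = ⌊ side p q A <? + 0 ⌋

sq : ℤ → ℤ
sq z = z ℤ.* z

-- squared distance, scaled by D², between the crossing point
-- γ(k/D) = (k q / D , k p / D) and a lattice point A
dist2 : ℕ → ℕ → ℕ → Point → ℤ
dist2 p q k (x , y) =
  sq (+ (k ℕ.* q) - + Den p q ℤ.* x) ℤ.+ sq (+ (k ℕ.* p) - + Den p q ℤ.* y)

-- odd-position sign f_{2i-1}; m is the sign chosen when s_i is the midpoint
oddSign : ℕ → ℕ → Sign → ℕ × Segment → Sign
oddSign p q m (k , (A , B)) =
  if ⌊ dR <? dL ⌋ then minus else if ⌊ dL <? dR ⌋ then plus else m
  where
  R = if isRight p q A then A else B
  L = if isRight p q A then B else A
  dR = dist2 p q k R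
  dL = dist2 p q k L

-- even-position sign f_{2i}: the common endpoint of σ_i and σ_{i+1}
evenSign : ℕ → ℕ → Segment → Segment → Sign
evenSign p q (A , B) (C , E) =
  if isRight p q P then minus else plus
  where
  P = if (A ==P C) ∨ (A ==P E) then A else B

inner : ℕ → ℕ → Sign → List (ℕ × Segment) → List Sign
inner p q m []                    = []
inner p q m (s ∷ [])              = oddSign p q m s ∷ []
inner p q m (s ∷ (t ∷ rest)) =
  oddSign p q m s ∷ evenSign p q (proj₂ s) (proj₂ t) ∷ inner p q m (t ∷ rest)

fseq : ℕ → ℕ → Sign → List Sign
fseq p q m = minus ∷ (inner p q m (crossings p q) ++ (plus ∷ []))

runsFrom : Sign → ℕ → List Sign → List ℕ
runsFrom x n []       = n ∷ []
runsFrom x n (y ∷ ys) = if sameSign x y then runsFrom x (suc n) ys else n ∷ runsFrom y 1 ys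

runs : List Sign → List ℕ
runs []       = []
runs (x ∷ xs) = runsFrom x 1 xs

C : ℕ → ℕ → Sign → List ℕ
C p q m = runs (fseq p q m)

β^ : ℕ → List ℕ
β^ j = concat (replicate j (3 ∷ 5 ∷ []))

β⁻¹^ : ℕ → List ℕ
β⁻¹^ j = concat (replicate j (5 ∷ 3 ∷ []))

{-# OPTIONS --safe #-}
-- Parametrise γ by k ∈ (0, Den), Den = pq(p + q), as γ(k / Den) = (kq, kp) / Den.  Its crossings
-- with the lines x = i, y = i and x + y = i are then the multiples of three periods, and the sign at a
-- crossing is decided by comparing twice its parameter with the sum of the parameters at which γ meets
-- the lattice lines through the two endpoints.  For p / q = n / (n + 1), comparing parameters by
-- cross-multiplication fixes the crossings row by row: row j contributes the signs − − σ + +,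
-- followed by + τ − unless it is the last row, where σ = + iff j ≤ n − 1 − j and τ = + iff
-- j ≤ n − 2 − j (the middle sign being +).  So the lower rows contribute β, the upper rows β⁻¹, and
-- the rows around the middle produce 3, 4 when q is even and 3, 5, 4, 3 when q is odd.
module Submission where

open import Data.Bool using (Bool; true; false; if_then_else_; _∧_; _∨_)
open import Data.Empty using (⊥-elim)
open import Data.Integer as ℤ using (+_; -[1+_]; _⊖_)
import Data.Integer.Properties as ℤ
open import Data.List using (List; []; _∷_; _++_; concatMap; applyUpTo)
open import Data.List.Properties using (++-assoc)
open import Data.Nat
open import Data.Nat.DivMod using (m≡m%n+[m/n]*n; m*n%n≡0; m*n/n≡m; m<n*o⇒m/o<n; /-monoˡ-≤)
open import Data.Nat.Divisibility using (_∣_; divides; ∣1⇒≡1; ∣m+n∣m⇒∣n)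
open import Data.Nat.Properties
open import Data.Nat.Tactic.RingSolver using (solve; solve-∀)
open import Data.Product using (Σ; _×_; _,_; proj₁; proj₂)
open import Data.Sum using (inj₁; inj₂)
open import Function using (_∘_)
open import Relation.Binary.PropositionalEquality
open import Relation.Nullary using (¬_; Dec; yes; no)
open import Relation.Nullary.Decidable using (⌊_⌋; isYes≗does; dec-true; dec-false)

open import Defs

private variable
  A : Set
  g : ℕ → List A

concatFrom : (ℕ → List A) → ℕ → ℕ → List A
concatFrom g lo zero      = []
concatFrom g lo (suc len) = g lo ++ concatFrom g (suc lo) len

between : (ℕ → List A) → ℕ → ℕ → List A
between g lo hi = concatFrom g lo (hi ∸ lo)

concatFrom-+ : ∀ (g : ℕ → List A) lo m n →
  concatFrom g lo (m + n) ≡ concatFrom g lo m ++ concatFrom g (m + lo) n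
concatFrom-+ g lo zero    n = refl
concatFrom-+ g lo (suc m) n = begin
  g lo ++ concatFrom g (suc lo) (m + n)
    ≡⟨ cong (g lo ++_) (concatFrom-+ g (suc lo) m n) ⟩
  g lo ++ (concatFrom g (suc lo) m ++ concatFrom g (m + suc lo) n)
    ≡⟨ cong (λ i → g lo ++ (concatFrom g (suc lo) m ++ concatFrom g i n)) (+-suc m lo) ⟩
  g lo ++ (concatFrom g (suc lo) m ++ concatFrom g (suc m + lo) n)
    ≡⟨ ++-assoc (g lo) _ _ ⟨
  (g lo ++ concatFrom g (suc lo) m) ++ concatFrom g (suc m + lo) n ∎
  where open ≡-Reasoning

between-++ : ∀ {lo mid hi} → lo ≤ mid → mid ≤ hi →
  between g lo hi ≡ between g lo mid ++ between g mid hi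
between-++ {g = g} {lo} lo≤mid mid≤hi with m≤n⇒∃[o]m+o≡n lo≤mid | m≤n⇒∃[o]m+o≡n mid≤hi
... | m , refl | n , refl = begin
  concatFrom g lo (lo + m + n ∸ lo)
    ≡⟨ cong (concatFrom g lo) (trans (cong (_∸ lo) (+-assoc lo m n)) (m+n∸m≡n lo (m + n))) ⟩
  concatFrom g lo (m + n)
    ≡⟨ concatFrom-+ g lo m n ⟩
  concatFrom g lo m ++ concatFrom g (m + lo) n
    ≡⟨ cong₂ (λ i j → concatFrom g lo i ++ concatFrom g (m + lo) j) (m+n∸m≡n lo m) (m+n∸m≡n (lo + m) n) ⟨
  concatFrom g lo (lo + m ∸ lo) ++ concatFrom g (m + lo) (lo + m + n ∸ (lo + m))
    ≡⟨ cong (λ i → concatFrom g lo (lo + m ∸ lo) ++ concatFrom g i (lo + m + n ∸ (lo + m))) (+-comm m lo) ⟩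
  concatFrom g lo (lo + m ∸ lo) ++ concatFrom g (lo + m) (lo + m + n ∸ (lo + m)) ∎
  where open ≡-Reasoning

between-∷ : ∀ {lo hi} → lo < hi → between g lo hi ≡ g lo ++ between g (suc lo) hi
between-∷ {g = g} {lo} {suc hi} (s≤s lo≤hi) = cong (concatFrom g lo) (+-∸-assoc 1 lo≤hi)

concatFrom-[] : ∀ lo len → (∀ k → lo ≤ k → k < len + lo → g k ≡ []) → concatFrom g lo len ≡ []
concatFrom-[] lo zero      empty = refl
concatFrom-[] lo (suc len) empty =
  cong₂ _++_ (empty lo ≤-refl (s≤s (m≤n+m lo len)))
    (concatFrom-[] (suc lo) len λ k lo<k k<len+1+lo → empty k (<⇒≤ lo<k) (subst (k <_) (+-suc len lo) k<len+1+lo))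

between-[] : ∀ {lo hi} → lo ≤ hi → (∀ k → lo ≤ k → k < hi → g k ≡ []) → between g lo hi ≡ []
between-[] {lo = lo} {hi} lo≤hi empty =
  concatFrom-[] lo (hi ∸ lo) λ k lo≤k k<hi → empty k lo≤k (subst (k <_) (m∸n+n≡m lo≤hi) k<hi)

between-next : ∀ {u k hi v} → u < k → k < hi → (∀ i → u < i → i < k → g i ≡ []) → g k ≡ v ∷ [] →
  between g (suc u) hi ≡ v ∷ between g (suc k) hi
between-next {g = g} {u} {k} {hi} {v} u<k k<hi empty gk = begin
  between g (suc u) hi                       ≡⟨ between-++ u<k (<⇒≤ k<hi) ⟩
  between g (suc u) k ++ between g k hi      ≡⟨ cong₂ _++_ (between-[] u<k empty) (between-∷ k<hi) ⟩
  g k ++ between g (suc k) hi                ≡⟨ cong (_++ between g (suc k) hi) gk ⟩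
  v ∷ between g (suc k) hi                   ∎
  where open ≡-Reasoning

concatMap-applyUpTo : ∀ (g : ℕ → List A) f lo len → (∀ i → f i ≡ lo + i) →
  concatMap (λ i → g (suc i)) (applyUpTo f len) ≡ concatFrom g (suc lo) len
concatMap-applyUpTo g f lo zero      f≗lo+ = refl
concatMap-applyUpTo g f lo (suc len) f≗lo+ =
  cong₂ _++_ (cong (λ i → g (suc i)) (trans (f≗lo+ 0) (+-identityʳ lo)))
    (concatMap-applyUpTo g (λ i → f (suc i)) (suc lo) len λ i → trans (f≗lo+ (suc i)) (+-suc lo i))

crossings≡between : ∀ p q → crossings p q ≡ between (crossingAt p q) 1 (Den p q)
crossings≡between p q = concatMap-applyUpTo (crossingAt p q) (λ i → i) 0 (Den p q ∸ 1) (λ i → refl)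

if-true : ∀ {b : Bool} {u v : A} → b ≡ true → (if b then u else v) ≡ u
if-true refl = refl

if-false : ∀ {b : Bool} {u v : A} → b ≡ false → (if b then u else v) ≡ v
if-false refl = refl

⌊⌋-true : ∀ {P : Set} (P? : Dec P) → P → ⌊ P? ⌋ ≡ true
⌊⌋-true P? p = trans (isYes≗does P?) (dec-true P? p)

⌊⌋-false : ∀ {P : Set} (P? : Dec P) → ¬ P → ⌊ P? ⌋ ≡ false
⌊⌋-false P? ¬p = trans (isYes≗does P?) (dec-false P? ¬p)

fl-≡ : ∀ {x d m} → m * d ≤ x → x < suc m * d → fl x d ≡ m
fl-≡ {x} {zero}      {m} _ x<0 = ⊥-elim (n≮0 (subst (x <_) (*-zeroʳ (suc m)) x<0))
fl-≡ {x} {d@(suc _)} {m} m*d≤x x<[1+m]*d =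
  ≤-antisym (s≤s⁻¹ (m<n*o⇒m/o<n x<[1+m]*d)) (subst (_≤ x / d) (m*n/n≡m m d) (/-monoˡ-≤ d m*d≤x))

record InsidePeriod (d m x : ℕ) : Set where
  constructor _,_
  field
    lower : m * d < x
    upper : x < suc m * d

fl-inside : ∀ {x d m} → InsidePeriod d m x → fl x d ≡ m
fl-inside (lower , upper) = fl-≡ (<⇒≤ lower) upper

fl-exact : ∀ {x d m} .{{_ : NonZero d}} → x ≡ m * d → fl x d ≡ m
fl-exact {d = d} {m} refl = fl-≡ ≤-refl (+-monoˡ-< (m * d) (>-nonZero⁻¹ d))

dvd-exact : ∀ {x d m} .{{_ : NonZero d}} → x ≡ m * d → dvd d x ≡ true
dvd-exact {d = suc d} {m} refl = cong (_==ℕ 0) (m*n%n≡0 m (suc d))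

dvd-inside : ∀ {x d m} → InsidePeriod d m x → dvd d x ≡ false
dvd-inside {d = zero} _ = refl
dvd-inside {x} {suc d} {m} inside@(lower , _) = ⌊⌋-false ((x % suc d) ≟ 0) λ x%d≡0 →
  <-irrefl (sym (begin
    x                             ≡⟨ m≡m%n+[m/n]*n x (suc d) ⟩
    x % suc d + x / suc d * suc d ≡⟨ cong₂ (λ r s → r + s * suc d) x%d≡0 (fl-inside {d = suc d} {m} inside) ⟩
    m * suc d                     ∎)) lower
  where open ≡-Reasoning

-- γ(k / Den p q) = (k q , k p) / Den p q meets the line x = i at k = i * periodˣ p q,
-- the line y = i at k = i * periodʸ p q, and the line x + y = i at k = i * periodᵈ p q.
periodˣ periodʸ periodᵈ : ℕ → ℕ → ℕ
periodˣ p q = p * (p + q)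
periodʸ p q = q * (p + q)
periodᵈ p q = p * q

periodˣ*q≡Den : ∀ p q → periodˣ p q * q ≡ Den p q
periodˣ*q≡Den p q = begin
  p * (p + q) * q   ≡⟨ *-assoc p (p + q) q ⟩
  p * ((p + q) * q) ≡⟨ cong (p *_) (*-comm (p + q) q) ⟩
  p * (q * (p + q)) ≡⟨ *-assoc p q (p + q) ⟨
  p * q * (p + q)   ∎
  where open ≡-Reasoning

periodʸ*p≡Den : ∀ p q → periodʸ p q * p ≡ Den p q
periodʸ*p≡Den p q = trans (*-comm (q * (p + q)) p) (sym (*-assoc p q (p + q)))

insidePeriod-* : ∀ {d m x} t .{{_ : NonZero t}} → InsidePeriod d m x → InsidePeriod (d * t) m (x * t)
insidePeriod-* {d} {m} {x} t (lower , upper) =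
  subst (_< x * t) (*-assoc m d t) (*-monoˡ-< t lower) , subst (x * t <_) (*-assoc (suc m) d t) (*-monoˡ-< t upper)

exact-* : ∀ {x} m d t → x ≡ m * d → x * t ≡ m * (d * t)
exact-* m d t refl = *-assoc m d t

+[m+n]-+m : ∀ m n → + (m + n) ℤ.- + m ≡ + n
+[m+n]-+m m n = trans (ℤ.m-n≡m⊖n (m + n) m) (trans (ℤ.⊖-≥ (m≤m+n m n)) (cong +_ (m+n∸m≡n m n)))

⊖-negative : ∀ {m n} → m < n → m ⊖ n ℤ.< + 0
⊖-negative {m} {n} m<n with m ⊖ n | ℤ.sign-⊖-< m<n
... | -[1+ _ ] | _ = ℤ.-<+

sq-+-+ : ∀ u v → sq (+ u ℤ.- + v) ≡ + (∣ u - v ∣ * ∣ u - v ∣)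
sq-+-+ u v with ≤-total v u
... | inj₁ v≤u = begin
  sq (+ u ℤ.- + v)           ≡⟨ cong sq (trans (ℤ.m-n≡m⊖n u v) (ℤ.⊖-≥ v≤u)) ⟩
  sq (+ (u ∸ v))             ≡⟨ ℤ.pos-* (u ∸ v) (u ∸ v) ⟨
  + ((u ∸ v) * (u ∸ v))      ≡⟨ cong (λ w → + (w * w)) (m≤n⇒∣n-m∣≡n∸m v≤u) ⟨
  + (∣ u - v ∣ * ∣ u - v ∣)  ∎
  where open ≡-Reasoning
... | inj₂ u≤v = begin
  sq (+ u ℤ.- + v)           ≡⟨ cong sq (trans (ℤ.m-n≡m⊖n u v) (ℤ.⊖-≤ u≤v)) ⟩
  sq (ℤ.- + (v ∸ u))         ≡⟨ sq-negate (v ∸ u) ⟩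
  + ((v ∸ u) * (v ∸ u))      ≡⟨ cong (λ w → + (w * w)) (m≤n⇒∣m-n∣≡n∸m u≤v) ⟨
  + (∣ u - v ∣ * ∣ u - v ∣)  ∎
  where
  open ≡-Reasoning
  sq-negate : ∀ w → sq (ℤ.- + w) ≡ + (w * w)
  sq-negate zero    = refl
  sq-negate (suc w) = refl

record WithinPeriod (d m u v : ℕ) : Set where
  constructor _,_
  field
    start : m * d ≤ u
    end   : v ≤ suc m * d

within⇒inside : ∀ {d m u v k} → WithinPeriod d m u v → u < k → k < v → InsidePeriod d m k
within⇒inside (start , end) u<k k<v = ≤-<-trans start u<k , <-≤-trans k<v end

xCrossing yCrossing dCrossing : ℕ → ℕ → ℕ → ℕ × Segment
xCrossing k x y = k , (+ x , + y) , (+ x , + suc y)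
yCrossing k x y = k , (+ x , + y) , (+ suc x , + y)
dCrossing k x y = k , (+ x , + suc y) , (+ suc x , + y)

==P-refl : ∀ P → (P ==P P) ≡ true
==P-refl (u , v) = cong₂ _∧_ (⌊⌋-true (u ℤ.≟ u) refl) (⌊⌋-true (v ℤ.≟ v) refl)

==P-≢ : ∀ {P Q} → P ≢ Q → (P ==P Q) ≡ false
==P-≢ {u , v} {u′ , v′} P≢Q with u ℤ.≟ u′
... | no _     = refl
... | yes refl = ⌊⌋-false (v ℤ.≟ v′) (λ v≡v′ → P≢Q (cong (u ,_) v≡v′))

module Crossings (p q : ℕ) .{{_ : NonZero p}} .{{_ : NonZero q}} where
  private
    instance
      p+q≢0 : NonZero (p + q)
      p+q≢0 = >-nonZero (<-≤-trans (>-nonZero⁻¹ p) (m≤m+n p q))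
      Den≢0 : NonZero (Den p q)
      Den≢0 = m*n≢0 (p * q) (p + q) {{m*n≢0 p q}}
    a = periodˣ p q
    b = periodʸ p q
    c = periodᵈ p q
    D = Den p q

    k[p+q]≡kq+kp : ∀ k → k * (p + q) ≡ k * q + k * p
    k[p+q]≡kq+kp k = trans (*-distribˡ-+ k p q) (+-comm (k * p) (k * q))

    inside-x : ∀ {k x} → InsidePeriod a x k → InsidePeriod D x (k * q)
    inside-x {k} {x} inside = subst (λ d → InsidePeriod d x (k * q)) (periodˣ*q≡Den p q) (insidePeriod-* q inside)

    inside-y : ∀ {k y} → InsidePeriod b y k → InsidePeriod D y (k * p)
    inside-y {k} {y} inside = subst (λ d → InsidePeriod d y (k * p)) (periodʸ*p≡Den p q) (insidePeriod-* p inside)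

    inside-d : ∀ {k m} → InsidePeriod c m k → InsidePeriod D m (k * q + k * p)
    inside-d {k} inside = subst (InsidePeriod D _) (k[p+q]≡kq+kp k) (insidePeriod-* (p + q) inside)

    side≡⊖ : ∀ x y → side p q (+ x , + y) ≡ (q * y) ⊖ (p * x)
    side≡⊖ x y = trans (cong₂ ℤ._-_ (sym (ℤ.pos-* q y)) (sym (ℤ.pos-* p x))) (ℤ.m-n≡m⊖n (q * y) (p * x))

  crossingAt-x : ∀ {k x y} → k ≡ x * a → InsidePeriod b y k → crossingAt p q k ≡ xCrossing k x y ∷ []
  crossingAt-x {k} {x} k≡xa inside =
    trans (if-true (dvd-exact {d = D} {x} kq≡xD))
          (cong₂ (λ i j → xCrossing k i j ∷ []) (fl-exact {d = D} {x} kq≡xD) (fl-inside (inside-y inside)))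
    where
    kq≡xD : k * q ≡ x * D
    kq≡xD = trans (exact-* x a q k≡xa) (cong (x *_) (periodˣ*q≡Den p q))

  crossingAt-y : ∀ {k x y} → InsidePeriod a x k → k ≡ y * b → crossingAt p q k ≡ yCrossing k x y ∷ []
  crossingAt-y {k} {y = y} inside k≡yb =
    trans (if-false (dvd-inside (inside-x inside))) (trans (if-true (dvd-exact {d = D} {y} kp≡yD))
          (cong₂ (λ i j → yCrossing k i j ∷ []) (fl-inside (inside-x inside)) (fl-exact {d = D} {y} kp≡yD)))
    where
    kp≡yD : k * p ≡ y * D
    kp≡yD = trans (exact-* y b p k≡yb) (cong (y *_) (periodʸ*p≡Den p q))

  crossingAt-d : ∀ {k x y} → InsidePeriod a x k → InsidePeriod b y k → k ≡ suc (x + y) * c →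
    crossingAt p q k ≡ dCrossing k x y ∷ []
  crossingAt-d {k} {x} {y} insideˣ insideʸ k≡[x+y+1]c = begin
    crossingAt p q k
      ≡⟨ trans (if-false (dvd-inside (inside-x insideˣ))) (trans (if-false (dvd-inside (inside-y insideʸ)))
                (if-true (dvd-exact {d = D} {suc (x + y)} k[p+q]≡[x+y+1]D))) ⟩
    (k , (+ fl (k * q) D , + fl (k * q + k * p) D ℤ.- + fl (k * q) D)
       , (+ suc (fl (k * q) D) , + fl (k * q + k * p) D ℤ.- + suc (fl (k * q) D))) ∷ []
      ≡⟨ cong₂ (λ i j → (k , (+ i , + j ℤ.- + i) , (+ suc i , + j ℤ.- + suc i)) ∷ [])
               (fl-inside (inside-x insideˣ)) (fl-exact {d = D} {suc (x + y)} k[p+q]≡[x+y+1]D) ⟩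
    (k , (+ x , + suc (x + y) ℤ.- + x) , (+ suc x , + suc (x + y) ℤ.- + suc x)) ∷ []
      ≡⟨ cong₂ (λ u v → (k , (+ x , u) , (+ suc x , v)) ∷ [])
               (subst (λ s → + s ℤ.- + x ≡ + suc y) (+-suc x y) (+[m+n]-+m x (suc y))) (+[m+n]-+m (suc x) y) ⟩
    dCrossing k x y ∷ [] ∎
    where
    open ≡-Reasoning
    k[p+q]≡[x+y+1]D : k * q + k * p ≡ suc (x + y) * D
    k[p+q]≡[x+y+1]D = trans (sym (k[p+q]≡kq+kp k)) (exact-* (suc (x + y)) c (p + q) k≡[x+y+1]c)

  crossingAt-none : ∀ {k x y m} → InsidePeriod a x k → InsidePeriod b y k → InsidePeriod c m k →
    crossingAt p q k ≡ []
  crossingAt-none insideˣ insideʸ insideᵈ =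
    trans (if-false (dvd-inside (inside-x insideˣ))) (trans (if-false (dvd-inside (inside-y insideʸ)))
          (if-false (dvd-inside (inside-d insideᵈ))))

  crossingAt-between : ∀ mˣ mʸ mᵈ {u v} → WithinPeriod a mˣ u v → WithinPeriod b mʸ u v → WithinPeriod c mᵈ u v →
    ∀ k → u < k → k < v → crossingAt p q k ≡ []
  crossingAt-between _ _ _ withinˣ withinʸ withinᵈ k u<k k<v =
    crossingAt-none (within⇒inside withinˣ u<k k<v) (within⇒inside withinʸ u<k k<v) (within⇒inside withinᵈ u<k k<v)

  isRight-true : ∀ x y → q * y < p * x → isRight p q (+ x , + y) ≡ true
  isRight-true x y qy<px =
    ⌊⌋-true (side p q (+ x , + y) ℤ.<? + 0) (subst (ℤ._< + 0) (sym (side≡⊖ x y)) (⊖-negative qy<px))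

  isRight-false : ∀ x y → p * x ≤ q * y → isRight p q (+ x , + y) ≡ false
  isRight-false x y px≤qy = ⌊⌋-false (side p q (+ x , + y) ℤ.<? + 0)
    (ℤ.≤⇒≯ (subst (+ 0 ℤ.≤_) (sym (trans (side≡⊖ x y) (ℤ.⊖-≥ px≤qy))) (ℤ.+≤+ z≤n)))

  dist2≡ : ∀ k x y → dist2 p q k (+ x , + y) ≡
    + (q * ∣ k - x * a ∣ * (q * ∣ k - x * a ∣) + p * ∣ k - y * b ∣ * (p * ∣ k - y * b ∣))
  dist2≡ k x y = begin
    sq (+ (k * q) ℤ.- + D ℤ.* + x) ℤ.+ sq (+ (k * p) ℤ.- + D ℤ.* + y)
      ≡⟨ cong₂ (λ u v → sq (+ (k * q) ℤ.- u) ℤ.+ sq (+ (k * p) ℤ.- v)) (sym (ℤ.pos-* D x)) (sym (ℤ.pos-* D y)) ⟩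
    sq (+ (k * q) ℤ.- + (D * x)) ℤ.+ sq (+ (k * p) ℤ.- + (D * y))
      ≡⟨ cong₂ ℤ._+_ (sq-+-+ (k * q) (D * x)) (sq-+-+ (k * p) (D * y)) ⟩
    + (∣ k * q - D * x ∣ * ∣ k * q - D * x ∣) ℤ.+ + (∣ k * p - D * y ∣ * ∣ k * p - D * y ∣)
      ≡⟨ cong₂ (λ u v → + (u * u) ℤ.+ + (v * v))
               (offset q a (periodˣ*q≡Den p q) x) (offset p b (periodʸ*p≡Den p q) y) ⟩
    + (q * ∣ k - x * a ∣ * (q * ∣ k - x * a ∣)) ℤ.+ + (p * ∣ k - y * b ∣ * (p * ∣ k - y * b ∣))
      ≡⟨ ℤ.pos-+ (q * ∣ k - x * a ∣ * (q * ∣ k - x * a ∣)) (p * ∣ k - y * b ∣ * (p * ∣ k - y * b ∣)) ⟨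
    + (q * ∣ k - x * a ∣ * (q * ∣ k - x * a ∣) + p * ∣ k - y * b ∣ * (p * ∣ k - y * b ∣)) ∎
    where
    open ≡-Reasoning
    offset : ∀ t d → d * t ≡ D → ∀ z → ∣ k * t - D * z ∣ ≡ t * ∣ k - z * d ∣
    offset t d dt≡D z =
      trans (cong₂ ∣_-_∣ (*-comm k t) (trans (cong (_* z) (sym dt≡D)) rearrange)) (sym (*-distribˡ-∣-∣ t k (z * d)))
      where
      rearrange : d * t * z ≡ t * (z * d)
      rearrange = solve (d ∷ t ∷ z ∷ [])

  dist2-<₂ : ∀ {k x y x′ y′} → ∣ k - x * a ∣ ≤ ∣ k - x′ * a ∣ → ∣ k - y * b ∣ < ∣ k - y′ * b ∣ →
    dist2 p q k (+ x , + y) ℤ.< dist2 p q k (+ x′ , + y′)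
  dist2-<₂ {k} {x} {y} {x′} {y′} ≤ˣ <ʸ = subst₂ ℤ._<_ (sym (dist2≡ k x y)) (sym (dist2≡ k x′ y′))
    (ℤ.+<+ (+-mono-≤-< (*-mono-≤ (*-monoʳ-≤ q ≤ˣ) (*-monoʳ-≤ q ≤ˣ))
                        (*-mono-< (*-monoʳ-< p <ʸ) (*-monoʳ-< p <ʸ))))

  dist2-<₁ : ∀ {k x y x′ y′} → ∣ k - x * a ∣ < ∣ k - x′ * a ∣ → ∣ k - y * b ∣ ≤ ∣ k - y′ * b ∣ →
    dist2 p q k (+ x , + y) ℤ.< dist2 p q k (+ x′ , + y′)
  dist2-<₁ {k} {x} {y} {x′} {y′} <ˣ ≤ʸ = subst₂ ℤ._<_ (sym (dist2≡ k x y)) (sym (dist2≡ k x′ y′))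
    (ℤ.+<+ (+-mono-<-≤ (*-mono-< (*-monoʳ-< q <ˣ) (*-monoʳ-< q <ˣ))
                        (*-mono-≤ (*-monoʳ-≤ p ≤ʸ) (*-monoʳ-≤ p ≤ʸ))))

  dist2-≤ : ∀ {k x y x′ y′} → ∣ k - x * a ∣ ≤ ∣ k - x′ * a ∣ → ∣ k - y * b ∣ ≤ ∣ k - y′ * b ∣ →
    dist2 p q k (+ x , + y) ℤ.≤ dist2 p q k (+ x′ , + y′)
  dist2-≤ {k} {x} {y} {x′} {y′} ≤ˣ ≤ʸ = subst₂ ℤ._≤_ (sym (dist2≡ k x y)) (sym (dist2≡ k x′ y′))
    (ℤ.+≤+ (+-mono-≤ (*-mono-≤ (*-monoʳ-≤ q ≤ˣ) (*-monoʳ-≤ q ≤ˣ))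
                      (*-mono-≤ (*-monoʳ-≤ p ≤ʸ) (*-monoʳ-≤ p ≤ʸ))))

  private
    oddSign-minus : ∀ {m k A B b} → isRight p q A ≡ b →
      dist2 p q k (if b then A else B) ℤ.< dist2 p q k (if b then B else A) → oddSign p q m (k , A , B) ≡ minus
    oddSign-minus refl nearer = if-true (⌊⌋-true (_ ℤ.<? _) nearer)

    oddSign-plus : ∀ {k A B b} → isRight p q A ≡ b →
      dist2 p q k (if b then B else A) ℤ.≤ dist2 p q k (if b then A else B) → oddSign p q plus (k , A , B) ≡ plus
    oddSign-plus refl notFarther = trans (if-false (⌊⌋-false (_ ℤ.<? _) (ℤ.≤⇒≯ notFarther))) (if-same _)
      where
      if-same : ∀ c → (if c then plus else plus) ≡ plus
      if-same true  = refl
      if-same false = refl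

  oddSign-x-minus : ∀ {m} k x y → isRight p q (+ x , + y) ≡ true →
    ∣ k - y * b ∣ < ∣ k - suc y * b ∣ → oddSign p q m (xCrossing k x y) ≡ minus
  oddSign-x-minus k x y right nearer = oddSign-minus {k = k} right (dist2-<₂ {k} {x} {y} {x} {suc y} ≤-refl nearer)

  oddSign-x-plus : ∀ k x y → isRight p q (+ x , + y) ≡ true →
    ∣ k - suc y * b ∣ ≤ ∣ k - y * b ∣ → oddSign p q plus (xCrossing k x y) ≡ plus
  oddSign-x-plus k x y right notFarther = oddSign-plus {k = k} right (dist2-≤ {k} {x} {suc y} {x} {y} ≤-refl notFarther)

  oddSign-y-minus : ∀ {m} k x y → isRight p q (+ x , + y) ≡ false →
    ∣ k - suc x * a ∣ < ∣ k - x * a ∣ → oddSign p q m (yCrossing k x y) ≡ minus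
  oddSign-y-minus k x y left nearer = oddSign-minus {k = k} left (dist2-<₁ {k} {suc x} {y} {x} {y} nearer ≤-refl)

  oddSign-y-plus : ∀ k x y → isRight p q (+ x , + y) ≡ false →
    ∣ k - x * a ∣ ≤ ∣ k - suc x * a ∣ → oddSign p q plus (yCrossing k x y) ≡ plus
  oddSign-y-plus k x y left notFarther = oddSign-plus {k = k} left (dist2-≤ {k} {x} {y} {suc x} {y} notFarther ≤-refl)

  oddSign-d-minus : ∀ {m} k x y → isRight p q (+ x , + suc y) ≡ false →
    ∣ k - suc x * a ∣ < ∣ k - x * a ∣ → ∣ k - y * b ∣ < ∣ k - suc y * b ∣ →
    oddSign p q m (dCrossing k x y) ≡ minus
  oddSign-d-minus k x y left nearerˣ nearerʸ =
    oddSign-minus {k = k} left (dist2-<₂ {k} {suc x} {y} {x} {suc y} (<⇒≤ nearerˣ) nearerʸ)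

  oddSign-d-plus : ∀ k x y → isRight p q (+ x , + suc y) ≡ false →
    ∣ k - x * a ∣ ≤ ∣ k - suc x * a ∣ → ∣ k - suc y * b ∣ ≤ ∣ k - y * b ∣ →
    oddSign p q plus (dCrossing k x y) ≡ plus
  oddSign-d-plus k x y left notFartherˣ notFartherʸ =
    oddSign-plus {k = k} left (dist2-≤ {k} {x} {suc y} {suc x} {y} notFartherˣ notFartherʸ)

  evenSign-shared₁ : ∀ A B E → evenSign p q (A , B) (A , E) ≡ (if isRight p q A then minus else plus)
  evenSign-shared₁ A B E =
    cong (λ t → if isRight p q (if t ∨ (A ==P E) then A else B) then minus else plus) (==P-refl A)

  evenSign-shared₂ : ∀ A B C E → A ≢ C → A ≢ E → evenSign p q (A , B) (C , E) ≡ (if isRight p q B then minus else plus)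
  evenSign-shared₂ A B C E A≢C A≢E =
    cong₂ (λ s t → if isRight p q (if s ∨ t then A else B) then minus else plus) (==P-≢ A≢C) (==P-≢ A≢E)

-- With P t = Q u = Den, the crossings k = α P and k = β Q happen at the times α / t and β / u of γ,
-- so they compare by cross-multiplication.
cross-< : ∀ α β t u w {P Q D} .{{_ : NonZero D}} →
  P * t ≡ D → Q * u ≡ D → α * u + suc w ≡ β * t → α * P < β * Q
cross-< α β t u w {P} {Q} {D} Pt≡D Qu≡D αu+1+w≡βt = *-cancelʳ-< (t * u) (α * P) (β * Q) (begin-strict
  α * P * (t * u)  ≡⟨ solve (α ∷ P ∷ t ∷ u ∷ []) ⟩
  α * u * (P * t)  ≡⟨ cong (α * u *_) Pt≡D ⟩
  α * u * D        <⟨ *-monoˡ-< D (subst (α * u <_) αu+1+w≡βt (m<m+n (α * u) z<s)) ⟩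
  β * t * D        ≡⟨ cong (β * t *_) Qu≡D ⟨
  β * t * (Q * u)  ≡⟨ solve (β ∷ Q ∷ t ∷ u ∷ []) ⟩
  β * Q * (t * u)  ∎)
  where open ≤-Reasoning

cross-≤ : ∀ α β t u w {P Q D} .{{_ : NonZero t}} .{{_ : NonZero u}} →
  P * t ≡ D → Q * u ≡ D → α * u + w ≡ β * t → α * P ≤ β * Q
cross-≤ α β t u w {P} {Q} {D} Pt≡D Qu≡D αu+w≡βt = *-cancelʳ-≤ (α * P) (β * Q) (t * u) {{m*n≢0 t u}} (begin
  α * P * (t * u)  ≡⟨ solve (α ∷ P ∷ t ∷ u ∷ []) ⟩
  α * u * (P * t)  ≡⟨ cong (α * u *_) Pt≡D ⟩
  α * u * D        ≤⟨ *-monoˡ-≤ D (subst (α * u ≤_) αu+w≡βt (m≤m+n (α * u) w)) ⟩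
  β * t * D        ≡⟨ cong (β * t *_) Qu≡D ⟨
  β * t * (Q * u)  ≡⟨ solve (β ∷ Q ∷ t ∷ u ∷ []) ⟩
  β * Q * (t * u)  ∎)
  where open ≤-Reasoning

midpoint-balance : ∀ {l k r} → l ≤ k → k ≤ r → (k + k) + ∣ k - r ∣ ≡ (l + r) + ∣ k - l ∣
midpoint-balance {l} l≤k k≤r with m≤n⇒∃[o]m+o≡n l≤k | m≤n⇒∃[o]m+o≡n k≤r
... | u , refl | v , refl = begin
  (l + u + (l + u)) + ∣ l + u - l + u + v ∣  ≡⟨ cong (λ z → l + u + (l + u) + z) (∣m-m+n∣≡n (l + u) v) ⟩
  (l + u + (l + u)) + v                      ≡⟨ solve (l ∷ u ∷ v ∷ []) ⟩
  (l + (l + u + v)) + u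
    ≡⟨ cong (λ z → l + (l + u + v) + z) (trans (∣-∣-comm (l + u) l) (∣m-m+n∣≡n l u)) ⟨
  (l + (l + u + v)) + ∣ l + u - l ∣          ∎
  where open ≡-Reasoning

balance-< : ∀ {x y m n} → x + m ≡ y + n → x < y → n < m
balance-< {x} {y} {m} {n} eq x<y = ≰⇒> λ m≤n → <-irrefl eq (+-mono-<-≤ x<y m≤n)

balance-≤ : ∀ {x y m n} → x + m ≡ y + n → x ≤ y → n ≤ m
balance-≤ {x} {y} {m} {n} eq x≤y = ≮⇒≥ λ m<n → <-irrefl eq (+-mono-≤-< x≤y m<n)

module _ (α Q m P : ℕ) (lower : m * P ≤ α * Q) (upper : α * Q ≤ suc m * P) where
  private
    balance : (α * Q + α * Q) + ∣ α * Q - suc m * P ∣ ≡ (m * P + suc m * P) + ∣ α * Q - m * P ∣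
    balance = midpoint-balance lower upper

  nearer-lower< : (α + α) * Q < (m + suc m) * P → ∣ α * Q - m * P ∣ < ∣ α * Q - suc m * P ∣
  nearer-lower< lt = balance-< balance (subst₂ _<_ (*-distribʳ-+ Q α α) (*-distribʳ-+ P m (suc m)) lt)

  nearer-lower≤ : (α + α) * Q ≤ (m + suc m) * P → ∣ α * Q - m * P ∣ ≤ ∣ α * Q - suc m * P ∣
  nearer-lower≤ le = balance-≤ balance (subst₂ _≤_ (*-distribʳ-+ Q α α) (*-distribʳ-+ P m (suc m)) le)

  nearer-upper< : (m + suc m) * P < (α + α) * Q → ∣ α * Q - suc m * P ∣ < ∣ α * Q - m * P ∣
  nearer-upper< lt = balance-< (sym balance) (subst₂ _<_ (*-distribʳ-+ P m (suc m)) (*-distribʳ-+ Q α α) lt)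

  nearer-upper≤ : (m + suc m) * P ≤ (α + α) * Q → ∣ α * Q - suc m * P ∣ ≤ ∣ α * Q - m * P ∣
  nearer-upper≤ le = balance-≤ (sym balance) (subst₂ _≤_ (*-distribʳ-+ P m (suc m)) (*-distribʳ-+ Q α α) le)

a b c : ℕ → ℕ
a n = periodˣ n (suc n)
b n = periodʸ n (suc n)
c n = periodᵈ n (suc n)

a-rate : ∀ n → a n * suc n ≡ Den n (suc n)
a-rate n = periodˣ*q≡Den n (suc n)

b-rate : ∀ n → b n * n ≡ Den n (suc n)
b-rate n = periodʸ*p≡Den n (suc n)

c-rate : ∀ n → c n * (n + suc n) ≡ Den n (suc n)
c-rate n = refl

<-by-+ : ∀ {x y} w → x + suc w ≡ y → x < y
<-by-+ {x} w refl = m<m+n x z<s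

row-order₁ : ∀ j e → let n = suc (j + e) in j * b n < suc (j + j) * c n
row-order₁ j e = let n = suc (j + e) in
  cross-< j (suc (j + j)) n (n + suc n) e (b-rate n) (c-rate n) (solve (j ∷ e ∷ []))

row-order₂ : ∀ j e → let n = suc (j + e) in suc (j + j) * c n < suc j * a n
row-order₂ j e = let n = suc (j + e) in
  cross-< (suc (j + j)) (suc j) (n + suc n) (suc n) e (c-rate n) (a-rate n) (solve (j ∷ e ∷ []))

row-order₃ : ∀ j m → let n = suc m in suc j * a n < suc (suc (j + j)) * c n
row-order₃ j m = let n = suc m in
  cross-< (suc j) (suc (suc (j + j))) (suc n) (n + suc n) j (a-rate n) (c-rate n) (solve (j ∷ m ∷ []))

row-order₄ : ∀ j m → let n = suc m in suc (suc (j + j)) * c n < suc j * b n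
row-order₄ j m = let n = suc m in
  cross-< (suc (suc (j + j))) (suc j) (n + suc n) n j (c-rate n) (b-rate n) (solve (j ∷ m ∷ []))

a-below-row : ∀ j m → let n = suc m in j * a n ≤ j * b n
a-below-row j m = let n = suc m in
  cross-≤ j j (suc n) n j (a-rate n) (b-rate n) (solve (j ∷ m ∷ []))

c-below-row : ∀ j m → let n = suc m in (j + j) * c n ≤ j * b n
c-below-row j m = let n = suc m in
  cross-≤ (j + j) j (n + suc n) n j (c-rate n) (b-rate n) (solve (j ∷ m ∷ []))

row-below-a : ∀ j e → let n = suc (j + e) in suc j * b n ≤ suc (suc j) * a n
row-below-a j e = let n = suc (j + e) in
  cross-≤ (suc j) (suc (suc j)) n (suc n) e (b-rate n) (a-rate n) (solve (j ∷ e ∷ []))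

row-below-a-strict : ∀ j e → let n = suc (j + suc e) in suc j * b n < suc (suc j) * a n
row-below-a-strict j e = let n = suc (j + suc e) in
  cross-< (suc j) (suc (suc j)) n (suc n) e (b-rate n) (a-rate n) (solve (j ∷ e ∷ []))

row-below-c : ∀ j e → let n = suc (j + e) in suc j * b n ≤ suc (suc (suc (j + j))) * c n
row-below-c j e = let n = suc (j + e) in
  cross-≤ (suc j) (suc (suc (suc (j + j)))) n (n + suc n) e (b-rate n) (c-rate n) (solve (j ∷ e ∷ []))

dEven-below-a : ∀ j e → let n = suc (j + e) in suc (suc (j + j)) * c n < suc (suc j) * a n
dEven-below-a j e = let n = suc (j + e) in
  cross-< (suc (suc (j + j))) (suc (suc j)) (n + suc n) (suc n) (suc (j + e + e)) (c-rate n) (a-rate n) (solve (j ∷ e ∷ []))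

xCrossing-upper-nearer : ∀ j e → j ≤ e → let n = suc (j + e) in (j + suc j) * b n ≤ (suc j + suc j) * a n
xCrossing-upper-nearer j e j≤e with m≤n⇒∃[o]m+o≡n j≤e
... | d , refl = let n = suc (j + (j + d)) in
  cross-≤ (j + suc j) (suc j + suc j) n (suc n) d (b-rate n) (a-rate n) (solve (j ∷ d ∷ []))

xCrossing-lower-nearer : ∀ j e → e < j → let n = suc (j + e) in (suc j + suc j) * a n < (j + suc j) * b n
xCrossing-lower-nearer j e e<j with m≤n⇒∃[o]m+o≡n e<j
... | d , refl = let j = suc (e + d) ; n = suc (j + e) in
  cross-< (suc j + suc j) (j + suc j) (suc n) n d (a-rate n) (b-rate n) (solve (e ∷ d ∷ []))

yCrossing-left-nearer : ∀ j e → j ≤ e → let n = suc (j + suc e) in (suc j + suc j) * b n ≤ (suc j + suc (suc j)) * a n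
yCrossing-left-nearer j e j≤e with m≤n⇒∃[o]m+o≡n j≤e
... | d , refl = let n = suc (j + suc (j + d)) in
  cross-≤ (suc j + suc j) (suc j + suc (suc j)) n (suc n) d (b-rate n) (a-rate n) (solve (j ∷ d ∷ []))

yCrossing-right-nearer : ∀ j e → e < j → let n = suc (j + suc e) in (suc j + suc (suc j)) * a n < (suc j + suc j) * b n
yCrossing-right-nearer j e e<j with m≤n⇒∃[o]m+o≡n e<j
... | d , refl = let j = suc (e + d) ; n = suc (j + suc e) in
  cross-< (suc j + suc (suc j)) (suc j + suc j) (suc n) n d (a-rate n) (b-rate n) (solve (e ∷ d ∷ []))

dOdd-right-nearerˣ : ∀ j m → let n = suc m in (j + suc j) * a n < (suc (j + j) + suc (j + j)) * c n
dOdd-right-nearerˣ j m = let n = suc m in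
  cross-< (j + suc j) (suc (j + j) + suc (j + j)) (suc n) (n + suc n) (j + j) (a-rate n) (c-rate n) (solve (j ∷ m ∷ []))

dOdd-right-nearerʸ : ∀ j m → let n = suc m in (suc (j + j) + suc (j + j)) * c n < (j + suc j) * b n
dOdd-right-nearerʸ j m = let n = suc m in
  cross-< (suc (j + j) + suc (j + j)) (j + suc j) (n + suc n) n (j + j) (c-rate n) (b-rate n) (solve (j ∷ m ∷ []))

dEven-left-nearerˣ : ∀ j e → let n = suc (j + e) in
  (suc (suc (j + j)) + suc (suc (j + j))) * c n ≤ (suc j + suc (suc j)) * a n
dEven-left-nearerˣ j e = let n = suc (j + e) in
  cross-≤ (suc (suc (j + j)) + suc (suc (j + j))) (suc j + suc (suc j)) (n + suc n) (suc n) (suc (e + e))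
          (c-rate n) (a-rate n) (solve (j ∷ e ∷ []))

dEven-left-nearerʸ : ∀ j e → let n = suc (j + e) in
  (j + suc j) * b n ≤ (suc (suc (j + j)) + suc (suc (j + j))) * c n
dEven-left-nearerʸ j e = let n = suc (j + e) in
  cross-≤ (j + suc j) (suc (suc (j + j)) + suc (suc (j + j))) n (n + suc n) (suc (e + e))
          (b-rate n) (c-rate n) (solve (j ∷ e ∷ []))

below-γ₁ : ∀ j e → let n = suc (j + e) in suc n * j < n * suc j
below-γ₁ j e = let n = suc (j + e) in <-by-+ {suc n * j} {n * suc j} e (solve (j ∷ e ∷ []))

below-γ₂ : ∀ j e → let n = suc (j + suc e) in suc n * suc j < n * suc (suc j)
below-γ₂ j e = let n = suc (j + suc e) in <-by-+ {suc n * suc j} {n * suc (suc j)} e (solve (j ∷ e ∷ []))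

signOf≤ : ℕ → ℕ → Sign
signOf≤ j e = if ⌊ j ≤? e ⌋ then plus else minus

signOf≤-≤ : ∀ {j e} → j ≤ e → signOf≤ j e ≡ plus
signOf≤-≤ {j} {e} j≤e = if-true (⌊⌋-true (j ≤? e) j≤e)

signOf≤-≰ : ∀ {j e} → j ≰ e → signOf≤ j e ≡ minus
signOf≤-≰ {j} {e} j≰e = if-false (⌊⌋-false (j ≤? e) j≰e)

n≢1+n : ∀ {n} → n ≢ suc n
n≢1+n = 1+n≢n ∘ sym

≢-fst : ∀ {x x′ y y′} → x ≢ x′ → _≢_ {A = Point} (+ x , + y) (+ x′ , + y′)
≢-fst x≢x′ eq = x≢x′ (ℤ.+-injective (cong proj₁ eq))

≢-snd : ∀ {x x′ y y′} → y ≢ y′ → _≢_ {A = Point} (+ x , + y) (+ x′ , + y′)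
≢-snd y≢y′ eq = y≢y′ (ℤ.+-injective (cong proj₂ eq))

-- Between the lines y = j and y = j + 1 (with e more rows above, so n = j + e + 1), γ crosses
-- x + y = 2j + 1, x = j + 1, x + y = 2j + 2 and then, unless the row is the last one, y = j + 1.
mutual
  crossingsFrom : ℕ → ℕ → ℕ → List (ℕ × Segment)
  crossingsFrom n j e = dCrossing (suc (j + j) * c n) j j ∷ xCrossing (suc j * a n) (suc j) j
                      ∷ dCrossing (suc (suc (j + j)) * c n) (suc j) j ∷ crossingsBeyond n j e

  crossingsBeyond : ℕ → ℕ → ℕ → List (ℕ × Segment)
  crossingsBeyond n j zero    = []
  crossingsBeyond n j (suc e) = yCrossing (suc j * b n) (suc j) (suc j) ∷ crossingsFrom n (suc j) e

module Row (j e : ℕ) where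
  n = suc (j + e)
  open Crossings n (suc n) public
  y₀ = j * b n
  d₁ = suc (j + j) * c n
  x₁ = suc j * a n
  d₂ = suc (suc (j + j)) * c n
  y₁ = suc j * b n

  y₀<d₁ : y₀ < d₁
  y₀<d₁ = row-order₁ j e
  d₁<x₁ : d₁ < x₁
  d₁<x₁ = row-order₂ j e
  x₁<d₂ : x₁ < d₂
  x₁<d₂ = row-order₃ j (j + e)
  d₂<y₁ : d₂ < y₁
  d₂<y₁ = row-order₄ j (j + e)

  y₀<x₁ : y₀ < x₁
  y₀<x₁ = <-trans y₀<d₁ d₁<x₁
  y₀<d₂ : y₀ < d₂
  y₀<d₂ = <-trans y₀<x₁ x₁<d₂
  d₁<y₁ : d₁ < y₁
  d₁<y₁ = <-trans d₁<x₁ (<-trans x₁<d₂ d₂<y₁)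
  x₁<y₁ : x₁ < y₁
  x₁<y₁ = <-trans x₁<d₂ d₂<y₁

  y₁≤Den : y₁ ≤ Den n (suc n)
  y₁≤Den = subst (y₁ ≤_) (trans (*-comm n (b n)) (b-rate n)) (*-monoˡ-≤ (b n) (s≤s (m≤m+n j e)))

  d₂<Den : d₂ < Den n (suc n)
  d₂<Den = <-≤-trans d₂<y₁ y₁≤Den

  gap₁ : ∀ k → y₀ < k → k < d₁ → crossingAt n (suc n) k ≡ []
  gap₁ = crossingAt-between j j (j + j)
    (a-below-row j (j + e) , <⇒≤ d₁<x₁) (≤-refl , <⇒≤ d₁<y₁) (c-below-row j (j + e) , ≤-refl)

  gap₂ : ∀ k → d₁ < k → k < x₁ → crossingAt n (suc n) k ≡ []
  gap₂ = crossingAt-between j j (suc (j + j))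
    (≤-trans (a-below-row j (j + e)) (<⇒≤ y₀<d₁) , ≤-refl) (<⇒≤ y₀<d₁ , <⇒≤ x₁<y₁) (≤-refl , <⇒≤ x₁<d₂)

  gap₃ : ∀ k → x₁ < k → k < d₂ → crossingAt n (suc n) k ≡ []
  gap₃ = crossingAt-between (suc j) j (suc (j + j))
    (≤-refl , <⇒≤ (dEven-below-a j e)) (<⇒≤ y₀<x₁ , <⇒≤ d₂<y₁) (<⇒≤ d₁<x₁ , ≤-refl)

  gap₄ : ∀ k → d₂ < k → k < y₁ → crossingAt n (suc n) k ≡ []
  gap₄ = crossingAt-between (suc j) j (suc (suc (j + j)))
    (<⇒≤ x₁<d₂ , row-below-a j e) (<⇒≤ y₀<d₂ , ≤-refl) (≤-refl , row-below-c j e)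

  at-d₁ : crossingAt n (suc n) d₁ ≡ dCrossing d₁ j j ∷ []
  at-d₁ = crossingAt-d (≤-<-trans (a-below-row j (j + e)) y₀<d₁ , d₁<x₁) (y₀<d₁ , d₁<y₁) refl

  at-x₁ : crossingAt n (suc n) x₁ ≡ xCrossing x₁ (suc j) j ∷ []
  at-x₁ = crossingAt-x refl (y₀<x₁ , x₁<y₁)

  at-d₂ : crossingAt n (suc n) d₂ ≡ dCrossing d₂ (suc j) j ∷ []
  at-d₂ = crossingAt-d (x₁<d₂ , dEven-below-a j e) (y₀<d₂ , d₂<y₁) refl

  between-row : between (crossingAt n (suc n)) (suc y₀) (Den n (suc n)) ≡
    dCrossing d₁ j j ∷ xCrossing x₁ (suc j) j ∷ dCrossing d₂ (suc j) j ∷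
    between (crossingAt n (suc n)) (suc d₂) (Den n (suc n))
  between-row =
    trans (between-next y₀<d₁ (<-trans d₁<x₁ (<-trans x₁<d₂ d₂<Den)) gap₁ at-d₁) (cong (dCrossing d₁ j j ∷_)
    (trans (between-next d₁<x₁ (<-trans x₁<d₂ d₂<Den) gap₂ at-x₁) (cong (xCrossing x₁ (suc j) j ∷_)
    (between-next x₁<d₂ d₂<Den gap₃ at-d₂))))

  left₀ : isRight n (suc n) (+ j , + suc j) ≡ false
  left₀ = isRight-false j (suc j) (*-mono-≤ (n≤1+n n) (n≤1+n j))

  right₁ : isRight n (suc n) (+ suc j , + j) ≡ true
  right₁ = isRight-true (suc j) j (below-γ₁ j e)

  left₁ : isRight n (suc n) (+ suc j , + suc j) ≡ false
  left₁ = isRight-false (suc j) (suc j) (*-monoˡ-≤ (suc j) (n≤1+n n))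

  odd-d₁ : oddSign n (suc n) plus (dCrossing d₁ j j) ≡ minus
  odd-d₁ = oddSign-d-minus d₁ j j left₀
    (nearer-upper< (suc (j + j)) (c n) j (a n) (≤-trans (a-below-row j (j + e)) (<⇒≤ y₀<d₁)) (<⇒≤ d₁<x₁)
                   (dOdd-right-nearerˣ j (j + e)))
    (nearer-lower< (suc (j + j)) (c n) j (b n) (<⇒≤ y₀<d₁) (<⇒≤ d₁<y₁) (dOdd-right-nearerʸ j (j + e)))

  even-d₁x₁ : evenSign n (suc n) (proj₂ (dCrossing d₁ j j)) (proj₂ (xCrossing x₁ (suc j) j)) ≡ minus
  even-d₁x₁ = trans (evenSign-shared₂ (+ j , + suc j) (+ suc j , + j) (+ suc j , + j) (+ suc j , + suc j)
                                      (≢-fst n≢1+n) (≢-fst n≢1+n))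
                    (if-true right₁)

  odd-x₁ : oddSign n (suc n) plus (xCrossing x₁ (suc j) j) ≡ signOf≤ j e
  odd-x₁ with j ≤? e
  ... | yes j≤e = oddSign-x-plus x₁ (suc j) j right₁
    (nearer-upper≤ (suc j) (a n) j (b n) (<⇒≤ y₀<x₁) (<⇒≤ x₁<y₁) (xCrossing-upper-nearer j e j≤e))
  ... | no j≰e = oddSign-x-minus x₁ (suc j) j right₁
    (nearer-lower< (suc j) (a n) j (b n) (<⇒≤ y₀<x₁) (<⇒≤ x₁<y₁) (xCrossing-lower-nearer j e (≰⇒> j≰e)))

  even-x₁d₂ : evenSign n (suc n) (proj₂ (xCrossing x₁ (suc j) j)) (proj₂ (dCrossing d₂ (suc j) j)) ≡ plus
  even-x₁d₂ = trans (evenSign-shared₂ (+ suc j , + j) (+ suc j , + suc j) (+ suc j , + suc j) (+ suc (suc j) , + j)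
                                      (≢-snd n≢1+n) (≢-fst n≢1+n))
                    (if-false left₁)

  odd-d₂ : oddSign n (suc n) plus (dCrossing d₂ (suc j) j) ≡ plus
  odd-d₂ = oddSign-d-plus d₂ (suc j) j left₁
    (nearer-lower≤ (suc (suc (j + j))) (c n) (suc j) (a n) (<⇒≤ x₁<d₂) (<⇒≤ (dEven-below-a j e))
                   (dEven-left-nearerˣ j e))
    (nearer-upper≤ (suc (suc (j + j))) (c n) j (b n) (<⇒≤ y₀<d₂) (<⇒≤ d₂<y₁) (dEven-left-nearerʸ j e))

module NonFinalRow (j e : ℕ) where
  open Row j (suc e) public

  y₁<Den : y₁ < Den n (suc n)
  y₁<Den = subst (y₁ <_) (trans (*-comm n (b n)) (b-rate n)) (*-monoˡ-< (b n) (s≤s (m<m+n j z<s)))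

  at-y₁ : crossingAt n (suc n) y₁ ≡ yCrossing y₁ (suc j) (suc j) ∷ []
  at-y₁ = crossingAt-y (x₁<y₁ , row-below-a-strict j e) refl

  even-d₂y₁ : evenSign n (suc n) (proj₂ (dCrossing d₂ (suc j) j)) (proj₂ (yCrossing y₁ (suc j) (suc j))) ≡ plus
  even-d₂y₁ = trans (evenSign-shared₁ (+ suc j , + suc j) (+ suc (suc j) , + j) (+ suc (suc j) , + suc j)) (if-false left₁)

  odd-y₁ : oddSign n (suc n) plus (yCrossing y₁ (suc j) (suc j)) ≡ signOf≤ j e
  odd-y₁ with j ≤? e
  ... | yes j≤e = oddSign-y-plus y₁ (suc j) (suc j) left₁
    (nearer-lower≤ (suc j) (b n) (suc j) (a n) (<⇒≤ x₁<y₁) (row-below-a j (suc e)) (yCrossing-left-nearer j e j≤e))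
  ... | no j≰e = oddSign-y-minus y₁ (suc j) (suc j) left₁
    (nearer-upper< (suc j) (b n) (suc j) (a n) (<⇒≤ x₁<y₁) (row-below-a j (suc e))
                   (yCrossing-right-nearer j e (≰⇒> j≰e)))

  right₂ : isRight n (suc n) (+ suc (suc j) , + suc j) ≡ true
  right₂ = isRight-true (suc (suc j)) (suc j) (below-γ₂ j e)

  even-y₁d : evenSign n (suc n) (proj₂ (yCrossing y₁ (suc j) (suc j)))
                               (proj₂ (dCrossing (suc (suc j + suc j) * c n) (suc j) (suc j))) ≡ minus
  even-y₁d = trans (evenSign-shared₂ (+ suc j , + suc j) (+ suc (suc j) , + suc j)
                                     (+ suc j , + suc (suc j)) (+ suc (suc j) , + suc j) (≢-snd n≢1+n) (≢-fst n≢1+n))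
                   (if-true right₂)

between-crossingsFrom : ∀ n j e → suc (j + e) ≡ n →
  between (crossingAt n (suc n)) (suc (j * b n)) (Den n (suc n)) ≡ crossingsFrom n j e
between-crossingsFrom .(suc (j + zero)) j zero refl =
  trans between-row (cong (λ rest → dCrossing d₁ j j ∷ xCrossing x₁ (suc j) j ∷ dCrossing d₂ (suc j) j ∷ rest)
    (between-[] d₂<Den λ k d₂<k k<Den → gap₄ k d₂<k (subst (k <_) Den≡y₁ k<Den)))
  where
  open Row j zero
  Den≡y₁ : Den n (suc n) ≡ y₁
  Den≡y₁ = trans (sym (b-rate n)) (trans (*-comm (b n) n) (cong (λ i → suc i * b n) (+-identityʳ j)))
between-crossingsFrom .(suc (j + suc e)) j (suc e) refl =
  trans between-row (cong (λ rest → dCrossing d₁ j j ∷ xCrossing x₁ (suc j) j ∷ dCrossing d₂ (suc j) j ∷ rest)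
    (trans (between-next d₂<y₁ y₁<Den gap₄ at-y₁)
           (cong (yCrossing y₁ (suc j) (suc j) ∷_) (between-crossingsFrom n (suc j) e (cong suc (sym (+-suc j e)))))))
  where open NonFinalRow j e

signsFrom : ℕ → ℕ → List Sign
signsFrom j zero    = minus ∷ minus ∷ signOf≤ j zero ∷ plus ∷ plus ∷ []
signsFrom j (suc e) =
  minus ∷ minus ∷ signOf≤ j (suc e) ∷ plus ∷ plus ∷ plus ∷ signOf≤ j e ∷ minus ∷ signsFrom (suc j) e

infixr 5 _∷≡_
_∷≡_ : ∀ {x y : A} {xs ys} → x ≡ y → xs ≡ ys → x ∷ xs ≡ y ∷ ys
_∷≡_ = cong₂ _∷_

inner-crossingsFrom : ∀ n j e → suc (j + e) ≡ n → inner n (suc n) plus (crossingsFrom n j e) ≡ signsFrom j e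
inner-crossingsFrom .(suc (j + zero)) j zero refl =
  odd-d₁ ∷≡ even-d₁x₁ ∷≡ odd-x₁ ∷≡ even-x₁d₂ ∷≡ odd-d₂ ∷≡ refl
  where open Row j zero
inner-crossingsFrom .(suc (j + suc e)) j (suc e) refl =
  odd-d₁ ∷≡ even-d₁x₁ ∷≡ odd-x₁ ∷≡ even-x₁d₂ ∷≡ odd-d₂ ∷≡ even-d₂y₁ ∷≡ odd-y₁ ∷≡ even-y₁d ∷≡
  inner-crossingsFrom n (suc j) e (cong suc (sym (+-suc j e)))
  where open NonFinalRow j e

fseq≡signsFrom : ∀ m → fseq (suc m) (suc (suc m)) plus ≡ minus ∷ (signsFrom 0 m ++ plus ∷ [])
fseq≡signsFrom m = cong (λ l → minus ∷ (l ++ plus ∷ []))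
  (trans (cong (inner (suc m) (suc (suc m)) plus)
               (trans (crossings≡between (suc m) (suc (suc m))) (between-crossingsFrom (suc m) 0 m refl)))
         (inner-crossingsFrom (suc m) 0 m refl))

runsFrom-row⁺⁺ : ∀ {x y} rest → x ≡ plus → y ≡ plus →
  runsFrom minus 1 (minus ∷ minus ∷ x ∷ plus ∷ plus ∷ plus ∷ y ∷ minus ∷ rest) ≡ 3 ∷ 5 ∷ runsFrom minus 1 rest
runsFrom-row⁺⁺ rest refl refl = refl

runsFrom-row⁺⁻ : ∀ {x y} rest → x ≡ plus → y ≡ minus →
  runsFrom minus 1 (minus ∷ minus ∷ x ∷ plus ∷ plus ∷ plus ∷ y ∷ minus ∷ rest) ≡ 3 ∷ 4 ∷ runsFrom minus 2 rest
runsFrom-row⁺⁻ rest refl refl = refl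

runsFrom-row⁻⁻ : ∀ {x y} k rest → x ≡ minus → y ≡ minus →
  runsFrom minus (suc k) (minus ∷ minus ∷ x ∷ plus ∷ plus ∷ plus ∷ y ∷ minus ∷ rest) ≡
  4 + k ∷ 3 ∷ runsFrom minus 2 rest
runsFrom-row⁻⁻ k rest refl refl = refl

runsFrom-lastRow⁻ : ∀ {x} k → x ≡ minus →
  runsFrom minus (suc k) (minus ∷ minus ∷ x ∷ plus ∷ plus ∷ plus ∷ []) ≡ 4 + k ∷ 3 ∷ []
runsFrom-lastRow⁻ k refl = refl

runs-upperRows : ∀ a j r tl → j + a ≤ suc r →
  runsFrom minus 1 (signsFrom j (a + r) ++ tl) ≡ β^ a ++ runsFrom minus 1 (signsFrom (j + a) r ++ tl)
runs-upperRows zero    j r tl _ = cong (λ i → runsFrom minus 1 (signsFrom i r ++ tl)) (sym (+-identityʳ j))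
runs-upperRows (suc a) j r tl j+1+a≤1+r =
  trans (runsFrom-row⁺⁺ (signsFrom (suc j) (a + r) ++ tl) (signOf≤-≤ (≤-trans j≤a+r (n≤1+n _))) (signOf≤-≤ j≤a+r))
        (cong (λ rest → 3 ∷ 5 ∷ rest)
          (trans (runs-upperRows a (suc j) r tl j+1+a≤1+r′)
                 (cong (λ i → β^ a ++ runsFrom minus 1 (signsFrom i r ++ tl)) (sym (+-suc j a)))))
  where
  j+1+a≤1+r′ : suc j + a ≤ suc r
  j+1+a≤1+r′ = subst (_≤ suc r) (+-suc j a) j+1+a≤1+r
  j≤a+r : j ≤ a + r
  j≤a+r = ≤-trans (m≤m+n j a) (≤-trans (s≤s⁻¹ j+1+a≤1+r′) (m≤n+m r a))

runs-lowerRows : ∀ r j k → r < j → runsFrom minus (suc k) (signsFrom j r ++ plus ∷ []) ≡ 4 + k ∷ 3 ∷ β⁻¹^ r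
runs-lowerRows zero    j k 0<j = runsFrom-lastRow⁻ k (signOf≤-≰ (<⇒≱ 0<j))
runs-lowerRows (suc r) j k r<j =
  trans (runsFrom-row⁻⁻ k (signsFrom (suc j) r ++ plus ∷ [])
                        (signOf≤-≰ (<⇒≱ r<j)) (signOf≤-≰ (<⇒≱ (<-trans (n<1+n r) r<j))))
        (cong (λ rest → 4 + k ∷ 3 ∷ rest) (runs-lowerRows r (suc j) 1 (<-trans (<-trans (n<1+n r) r<j) (n<1+n j))))

runs-middleRow : ∀ t → runsFrom minus 1 (signsFrom t t ++ plus ∷ []) ≡ 3 ∷ 4 ∷ β⁻¹^ t
runs-middleRow zero    = refl
runs-middleRow (suc t) =
  trans (runsFrom-row⁺⁻ (signsFrom (suc (suc t)) t ++ plus ∷ []) (signOf≤-≤ ≤-refl) (signOf≤-≰ (<⇒≱ (n<1+n t))))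
        (cong (λ rest → 3 ∷ 4 ∷ rest) (runs-lowerRows t (suc (suc t)) 1 (<-trans (n<1+n t) (n<1+n (suc t)))))

β^-suc : ∀ t ys → β^ (suc t) ++ ys ≡ β^ t ++ (3 ∷ 5 ∷ ys)
β^-suc zero    ys = refl
β^-suc (suc t) ys = cong (λ rest → 3 ∷ 5 ∷ rest) (β^-suc t ys)

[t+t]/2≡t : ∀ t → (t + t) / 2 ≡ t
[t+t]/2≡t t = trans (cong (_/ 2) (+-*-2 t)) (m*n/n≡m t 2)
  where
  +-*-2 : ∀ t → t + t ≡ t * 2
  +-*-2 = solve-∀

C-even : ∀ t → C (suc (t + t)) (suc (suc (t + t))) plus ≡ β^ ((t + t) / 2) ++ (3 ∷ 4 ∷ []) ++ β⁻¹^ ((t + t) / 2)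
C-even t = begin
  runs (fseq (suc (t + t)) (suc (suc (t + t))) plus)  ≡⟨ cong runs (fseq≡signsFrom (t + t)) ⟩
  runsFrom minus 1 (signsFrom 0 (t + t) ++ plus ∷ []) ≡⟨ runs-upperRows t 0 t (plus ∷ []) (n≤1+n t) ⟩
  β^ t ++ runsFrom minus 1 (signsFrom t t ++ plus ∷ []) ≡⟨ cong (β^ t ++_) (runs-middleRow t) ⟩
  β^ t ++ (3 ∷ 4 ∷ []) ++ β⁻¹^ t                       ≡⟨ cong (λ h → β^ h ++ (3 ∷ 4 ∷ []) ++ β⁻¹^ h) ([t+t]/2≡t t) ⟨
  β^ ((t + t) / 2) ++ (3 ∷ 4 ∷ []) ++ β⁻¹^ ((t + t) / 2) ∎
  where open ≡-Reasoning

C-odd : ∀ t → C (suc (suc (t + t))) (suc (suc (suc (t + t)))) plus ≡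
  β^ ((t + t) / 2) ++ (3 ∷ 5 ∷ 4 ∷ 3 ∷ []) ++ β⁻¹^ ((t + t) / 2)
C-odd t = begin
  runs (fseq (suc (suc (t + t))) (suc (suc (suc (t + t)))) plus)
    ≡⟨ cong runs (fseq≡signsFrom (suc t + t)) ⟩
  runsFrom minus 1 (signsFrom 0 (suc t + t) ++ plus ∷ [])
    ≡⟨ runs-upperRows (suc t) 0 t (plus ∷ []) ≤-refl ⟩
  β^ (suc t) ++ runsFrom minus 1 (signsFrom (suc t) t ++ plus ∷ [])
    ≡⟨ cong (β^ (suc t) ++_) (runs-lowerRows t (suc t) 0 (n<1+n t)) ⟩
  β^ (suc t) ++ (4 ∷ 3 ∷ β⁻¹^ t)
    ≡⟨ β^-suc t _ ⟩
  β^ t ++ (3 ∷ 5 ∷ 4 ∷ 3 ∷ []) ++ β⁻¹^ t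
    ≡⟨ cong (λ h → β^ h ++ (3 ∷ 5 ∷ 4 ∷ 3 ∷ []) ++ β⁻¹^ h) ([t+t]/2≡t t) ⟨
  β^ ((t + t) / 2) ++ (3 ∷ 5 ∷ 4 ∷ 3 ∷ []) ++ β⁻¹^ ((t + t) / 2) ∎
  where open ≡-Reasoning

data Halving : ℕ → Set where
  even : ∀ t → Halving (t + t)
  odd  : ∀ t → Halving (suc (t + t))

halving : ∀ k → Halving k
halving zero = even 0
halving (suc k) with halving k
... | even t = odd t
... | odd t  = subst Halving (cong suc (+-suc t t)) (even (suc t))

2∣2+t+t : ∀ t → 2 ∣ suc (suc (t + t))
2∣2+t+t t = divides (suc t) (solve (t ∷ []))

2∤3+t+t : ∀ t → ¬ 2 ∣ suc (suc (suc (t + t)))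
2∤3+t+t t 2∣3+t+t with ∣1⇒≡1 (∣m+n∣m⇒∣n (subst (2 ∣_) (+-comm 1 (suc (suc (t + t)))) 2∣3+t+t) (2∣2+t+t t))
... | ()

lemma4p10 : (q : ℕ) → 2 ≤ q →
    Σ Sign (λ m →
      (2 ∣ q → C (q ∸ 1) q m ≡ β^ ((q ∸ 2) / 2) ++ (3 ∷ 4 ∷ []) ++ β⁻¹^ ((q ∸ 2) / 2))
      × (¬ (2 ∣ q) → C (q ∸ 1) q m ≡ β^ ((q ∸ 3) / 2) ++ (3 ∷ 5 ∷ 4 ∷ 3 ∷ []) ++ β⁻¹^ ((q ∸ 3) / 2)))
lemma4p10 (suc zero) (s≤s ())
lemma4p10 (suc (suc k)) _ with halving k
... | even t = plus , (λ _ → C-even t) , (λ 2∤q → ⊥-elim (2∤q (2∣2+t+t t)))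
... | odd t  = plus , (λ 2∣q → ⊥-elim (2∤3+t+t t 2∣q)) , (λ _ → C-odd t)
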